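{- Let $d\geq 2$, let $\alpha_1,\dots,\alpha_d\in\mathbb Z$ with $\alpha_d\neq 0$, and let $s\in\mathbb N^{\mathbb N}$ satisfy $s(n+d)+\alpha_1s(n+d-1)+\dots+\alpha_ds(n)=0$ for all $n\geq0$. Let $B(X)=\alpha_d+\alpha_{d-1}X+\dots+\alpha_1X^{d-1}+X^d$, let $S_{d-1}(X)=s(d-1)+s(d-2)X+\dots+s(0)X^{d-1}$, and let $A(X)$ be the quotient of $B(X)S_{d-1}(X)$ upon division by $X^d$ (i.e. the unique polynomial with $B(X)S_{d-1}(X)=C(X)+X^dA(X)$ and $\deg C<d$). Then there is $n_0$ such that, for every sufficiently large $b\in\mathbb N$, for all $n\geq n_0$, $$s(n)=\frac{1}{|\alpha_d|}\Big(\Big(\big(b^{n(d-1)+\lceil n/2\rceil}-b^{n(n+1)}\operatorname{sgn}(\alpha_d)A(b^n)\big)\bmod B(b^n)\Big)\bmod b^n\Big).$$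
   Context: $\mathbb N=\{0,1,2,\dots\}$. For integers $x$ and $y\neq0$, $x\bmod y$ denotes the unique integer $m$ with $0\leq m<|y|$ and $y\mid x-m$ (so it is nonnegative even when $x$ is negative). $\operatorname{sgn}(\alpha_d)\in\{ -1,1\}$ is the sign of $\alpha_d$. -}

module Defs where

open import Data.Nat as ℕ using (ℕ; zero; suc)
open import Data.Integer as ℤ using (ℤ; +_; -[1+_]; _+_; _*_; -_; _<_)
open import Data.Integer.DivMod using (_%_)
open import Data.List using (List; []; _∷_; drop; map; upTo)
open import Relation.Nullary using (yes; no)

-- Polynomials over ℤ as coefficient lists, lowest degree first:
-- (c₀ ∷ c₁ ∷ … ∷ cₖ ∷ []) represents c₀ + c₁ X + … + cₖ X^k.
Poly : Set
Poly = List ℤ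

_⊕_ : Poly → Poly → Poly
[] ⊕ q = q
(a ∷ p) ⊕ [] = a ∷ p
(a ∷ p) ⊕ (b ∷ q) = (a + b) ∷ (p ⊕ q)

_·_ : ℤ → Poly → Poly
c · p = map (c *_) p

_⊗_ : Poly → Poly → Poly
[] ⊗ q = []
(a ∷ p) ⊗ q = (a · q) ⊕ (+ 0 ∷ (p ⊗ q))

eval : Poly → ℤ → ℤ
eval [] x = + 0
eval (a ∷ p) x = a + x * eval p x

quotXpow : ℕ → Poly → Poly
quotXpow d p = drop d p

-- B(X) = α_d + α_{d-1} X + … + α_1 X^{d-1} + X^d
-- (α is indexed 1..d; coefficient of X^k is α (d - k) for k < d)
Bpoly : ℕ → (ℕ → ℤ) → Poly
Bpoly d α = map (λ k → α (d ℕ.∸ k)) (upTo d) Data.List.++ (+ 1 ∷ [])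

Spoly : ℕ → (ℕ → ℕ) → Poly
Spoly d s = map (λ k → + s (d ℕ.∸ 1 ℕ.∸ k)) (upTo d)

Apoly : ℕ → (ℕ → ℤ) → (ℕ → ℕ) → Poly
Apoly d α s = quotXpow d (Bpoly d α ⊗ Spoly d s)

-- sgn x ∈ {-1, 1} (only used for x ≠ 0)
sgn : ℤ → ℤ
sgn x with x ℤ.<? + 0
... | yes _ = - (+ 1)
... | no _ = + 1

-- x mod y : the unique m with 0 ≤ m < |y| and y ∣ x - m  (y ≠ 0).
-- For y = 0 the value is an arbitrary junk value (x); the theorem below
-- separately asserts that all divisors used are nonzero.
modℤ : ℤ → ℤ → ℤ
modℤ x (+ zero) = x
modℤ x y@(+ suc _) = + (x % y)
modℤ x y@(-[1+ _ ]) = + (x % y)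

sumℤ : List ℤ → ℤ
sumℤ [] = + 0
sumℤ (x ∷ xs) = x + sumℤ xs

recSum : ℕ → (ℕ → ℤ) → (ℕ → ℕ) → ℕ → ℤ
recSum d α s n = sumℤ (map (λ i → α (suc i) * + s (n ℕ.+ d ℕ.∸ suc i)) (upTo d))

{-# OPTIONS --safe #-}
module Submission where

-- Put x = b^n and B = B(x).  The partial sums e_m(t) = s(m+t) + α₁ s(m+t-1) + … + α_t s(m)
-- (partialSum) vanish at t = d by the recurrence, and H_m = Σ_{t<d} e_m(t) x^(d-1-t) is the
-- tail of the expansion H₀/B = Σ_k s(k) x^(-k-1): for every m, x^m H₀ = B S_{m-1}(x) + H_m.
-- Comparing the case m = d with B S_{d-1} = C + x^d A gives x^d (H₀ - A(x)) = C + H_d, which is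
-- smaller than x^d for large x, so A(x) = H₀.  The numerator is therefore congruent modulo B to
-- R = x^(d-1) b^⌈n/2⌉ - sgn(α_d) H_{n+1}.  Since s grows at most exponentially,
-- |H_{n+1}| < x^(d-1) b^⌈n/2⌉ and 2 x^(d-1) b^⌈n/2⌉ < |B| once b is large, so R is the
-- remainder itself.  Finally R ≡ -sgn(α_d) e_{n+1}(d-1) = sgn(α_d) α_d s(n) = |α_d| s(n)
-- modulo x, and 0 ≤ |α_d| s(n) < x.

open import Defs
open import Data.Nat using (ℕ; zero; suc; z≤n; s≤s; _≤_; _<_; _≥_; ⌈_/2⌉; ⌊_/2⌋)
import Data.Nat as ℕ
import Data.Nat.Properties as ℕₚ
open import Data.Nat.Induction using (<-rec)
import Data.Nat.Tactic.RingSolver as ℕ-Solver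
open import Data.Integer using (ℤ; NonZero; +_; -[1+_]; _+_; _*_; _-_; -_; _^_; ∣_∣)
import Data.Integer.Properties as ℤₚ
open import Data.Integer.DivMod using (_%_; _/_; n%d<d; a≡a%n+[a/n]*n)
open import Data.Integer.Tactic.RingSolver using (solve-∀)
open import Data.List using ([]; _∷_; _++_; take; drop; map; upTo; applyUpTo; length)
import Data.List.Properties as Listₚ
open import Data.Product using (Σ; _×_; _,_)
open import Data.Sum using (inj₁; inj₂)
open import Function using (_∘_)
open import Relation.Binary.PropositionalEquality
open import Relation.Nullary using (yes; no; contradiction)

1≤m^n : ∀ {m} n → 1 ≤ m → 1 ≤ m ℕ.^ n
1≤m^n {m} n m≥1 = ℕₚ.m^n>0 m {{ℕ.>-nonZero m≥1}} n

^-monoʳ-≤′ : ∀ {m i j} → 1 ≤ m → i ≤ j → m ℕ.^ i ≤ m ℕ.^ j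
^-monoʳ-≤′ {m} m≥1 = ℕₚ.^-monoʳ-≤ m {{ℕ.>-nonZero m≥1}}

m≤m*n′ : ∀ m {n} → 1 ≤ n → m ≤ m ℕ.* n
m≤m*n′ m {n} n≥1 = ℕₚ.m≤m*n m n {{ℕ.>-nonZero n≥1}}

m≤n*m′ : ∀ m {n} → 1 ≤ n → m ≤ n ℕ.* m
m≤n*m′ m {n} n≥1 = ℕₚ.m≤n*m m n {{ℕ.>-nonZero n≥1}}

*-monoˡ-<′ : ∀ {m n} o → 1 ≤ o → m < n → m ℕ.* o < n ℕ.* o
*-monoˡ-<′ o o≥1 = ℕₚ.*-monoˡ-< o {{ℕ.>-nonZero o≥1}}

∑ : ℕ → (ℕ → ℕ) → ℕ
∑ zero    f = 0
∑ (suc t) f = ∑ t f ℕ.+ f t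

∑-mono-≤ : ∀ t {f g} → (∀ i → f i ≤ g i) → ∑ t f ≤ ∑ t g
∑-mono-≤ zero    f≤g = z≤n
∑-mono-≤ (suc t) f≤g = ℕₚ.+-mono-≤ (∑-mono-≤ t f≤g) (f≤g t)

∑-distribʳ-* : ∀ t f c → ∑ t (λ i → f i ℕ.* c) ≡ ∑ t f ℕ.* c
∑-distribʳ-* zero    f c = refl
∑-distribʳ-* (suc t) f c =
  trans (cong (ℕ._+ f t ℕ.* c) (∑-distribʳ-* t f c)) (sym (ℕₚ.*-distribʳ-+ c (∑ t f) (f t)))

term≤∑ : ∀ {t i} f → i < t → f i ≤ ∑ t f
term≤∑ {suc t} {i} f i<1+t with ℕₚ.m<1+n⇒m<n∨m≡n i<1+t
... | inj₁ i<t  = ℕₚ.≤-trans (term≤∑ f i<t) (ℕₚ.m≤m+n (∑ t f) (f t))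
... | inj₂ refl = ℕₚ.m≤n+m (f t) (∑ t f)

^-distribʳ-* : ∀ m n k → (m ℕ.* n) ℕ.^ k ≡ m ℕ.^ k ℕ.* n ℕ.^ k
^-distribʳ-* m n zero    = refl
^-distribʳ-* m n (suc k) =
  trans (cong (m ℕ.* n ℕ.*_) (^-distribʳ-* m n k)) (interchange m n (m ℕ.^ k) (n ℕ.^ k))
  where
  interchange : ∀ a b c e → a ℕ.* b ℕ.* (c ℕ.* e) ≡ a ℕ.* c ℕ.* (b ℕ.* e)
  interchange = ℕ-Solver.solve-∀

m≤m^n : ∀ {m n} → 1 ≤ m → 1 ≤ n → m ≤ m ℕ.^ n
m≤m^n {m} {n} m≥1 n≥1 = subst (_≤ m ℕ.^ n) (ℕₚ.*-identityʳ m) (^-monoʳ-≤′ m≥1 n≥1)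

L*M^m<[[1+L]*M^k]^h : ∀ L {M m k h} → 1 ≤ M → 1 ≤ h → m ≤ k ℕ.* h →
                      L ℕ.* M ℕ.^ m < (suc L ℕ.* M ℕ.^ k) ℕ.^ h
L*M^m<[[1+L]*M^k]^h L {M} {m} {k} {h} M≥1 h≥1 m≤kh = begin-strict
  L ℕ.* M ℕ.^ m                   <⟨ *-monoˡ-<′ (M ℕ.^ m) (1≤m^n m M≥1) (ℕₚ.n<1+n L) ⟩
  suc L ℕ.* M ℕ.^ m               ≤⟨ ℕₚ.*-mono-≤ (m≤m^n (s≤s z≤n) h≥1) (^-monoʳ-≤′ M≥1 m≤kh) ⟩
  suc L ℕ.^ h ℕ.* M ℕ.^ (k ℕ.* h) ≡⟨ cong (suc L ℕ.^ h ℕ.*_) (sym (ℕₚ.^-*-assoc M k h)) ⟩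
  suc L ℕ.^ h ℕ.* (M ℕ.^ k) ℕ.^ h ≡⟨ sym (^-distribʳ-* (suc L) (M ℕ.^ k) h) ⟩
  (suc L ℕ.* M ℕ.^ k) ℕ.^ h       ∎
  where open ℕₚ.≤-Reasoning

b^h+b^h+D≤b^n : ∀ {b h n} D → 2 ℕ.+ D ≤ b → h < n → b ℕ.^ h ℕ.+ b ℕ.^ h ℕ.+ D ≤ b ℕ.^ n
b^h+b^h+D≤b^n {b} {h} {n} D 2+D≤b h<n = begin
  b ℕ.^ h ℕ.+ b ℕ.^ h ℕ.+ D             ≤⟨ ℕₚ.+-monoʳ-≤ (b ℕ.^ h ℕ.+ b ℕ.^ h) (m≤m*n′ D (1≤m^n h b≥1)) ⟩
  b ℕ.^ h ℕ.+ b ℕ.^ h ℕ.+ D ℕ.* b ℕ.^ h ≡⟨ collect (b ℕ.^ h) D ⟩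
  (2 ℕ.+ D) ℕ.* b ℕ.^ h                 ≤⟨ ℕₚ.*-monoˡ-≤ (b ℕ.^ h) 2+D≤b ⟩
  b ℕ.^ suc h                           ≤⟨ ^-monoʳ-≤′ b≥1 h<n ⟩
  b ℕ.^ n                               ∎
  where
  open ℕₚ.≤-Reasoning
  b≥1 : 1 ≤ b
  b≥1 = ℕₚ.≤-trans (s≤s z≤n) 2+D≤b
  collect : ∀ Y D → Y ℕ.+ Y ℕ.+ D ℕ.* Y ≡ (2 ℕ.+ D) ℕ.* Y
  collect = ℕ-Solver.solve-∀

1≤⌈n/2⌉ : ∀ {n} → 2 ≤ n → 1 ≤ ⌈ n /2⌉
1≤⌈n/2⌉ (s≤s (s≤s _)) = s≤s z≤n

⌈n/2⌉<n : ∀ {n} → 2 ≤ n → ⌈ n /2⌉ < n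
⌈n/2⌉<n {suc (suc n)} (s≤s (s≤s _)) = ℕₚ.⌈n/2⌉<n n

1+n≤3*⌈n/2⌉ : ∀ {n} → 2 ≤ n → suc n ≤ 3 ℕ.* ⌈ n /2⌉
1+n≤3*⌈n/2⌉ {n} n≥2 = begin
  suc n                             ≡⟨ cong suc (sym (ℕₚ.⌊n/2⌋+⌈n/2⌉≡n n)) ⟩
  suc (⌊ n /2⌋ ℕ.+ ⌈ n /2⌉)          ≤⟨ ℕₚ.+-mono-≤ (1≤⌈n/2⌉ n≥2) (ℕₚ.+-monoˡ-≤ ⌈ n /2⌉ (ℕₚ.⌊n/2⌋≤⌈n/2⌉ n)) ⟩
  ⌈ n /2⌉ ℕ.+ (⌈ n /2⌉ ℕ.+ ⌈ n /2⌉)  ≡⟨ thrice ⌈ n /2⌉ ⟩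
  3 ℕ.* ⌈ n /2⌉                     ∎
  where
  open ℕₚ.≤-Reasoning
  thrice : ∀ h → h ℕ.+ (h ℕ.+ h) ≡ 3 ℕ.* h
  thrice = ℕ-Solver.solve-∀

pos-^ : ∀ m k → (+ m) ^ k ≡ + (m ℕ.^ k)
pos-^ m zero    = refl
pos-^ m (suc k) = trans (cong (+ m *_) (pos-^ m k)) (sym (ℤₚ.pos-* m (m ℕ.^ k)))

sgn-abs : ∀ z → ∣ sgn z ∣ ≡ 1
sgn-abs (+ zero)  = refl
sgn-abs (+ suc _) = refl
sgn-abs -[1+ _ ]  = refl

sgn*self : ∀ z → z ≢ + 0 → sgn z * z ≡ + ∣ z ∣
sgn*self (+ zero)  z≢0 = contradiction refl z≢0
sgn*self (+ suc n) _   = ℤₚ.*-identityˡ (+ suc n)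
sgn*self -[1+ n ]  _   = ℤₚ.-1*i≡-i -[1+ n ]

i+j≡0⇒i≡-j : ∀ i j → i + j ≡ + 0 → i ≡ - j
i+j≡0⇒i≡-j i j i+j≡0 = trans (i≡[i+j]-j i j) (trans (cong (_- j) i+j≡0) (ℤₚ.+-identityˡ (- j)))
  where
  i≡[i+j]-j : ∀ i j → i ≡ (i + j) - j
  i≡[i+j]-j = solve-∀

∣i∣≤∣i+j∣+∣j∣ : ∀ i j → ∣ i ∣ ≤ ∣ i + j ∣ ℕ.+ ∣ j ∣
∣i∣≤∣i+j∣+∣j∣ i j = subst (λ k → ∣ k ∣ ≤ ∣ i + j ∣ ℕ.+ ∣ j ∣) (i+j-j≡i i j) (ℤₚ.∣i-j∣≤∣i∣+∣j∣ (i + j) j)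
  where
  i+j-j≡i : ∀ i j → (i + j) - j ≡ i
  i+j-j≡i = solve-∀

n-w≡+∣n-w∣ : ∀ n w → ∣ w ∣ ≤ n → + n - w ≡ + ∣ + n - w ∣
n-w≡+∣n-w∣ n (+ k)    k≤n rewrite ℤₚ.m-n≡m⊖n n k | ℤₚ.⊖-≥ k≤n = refl
n-w≡+∣n-w∣ n -[1+ k ] _   = refl

∣k*y∣<∣y∣⇒k≡0 : ∀ k y → ∣ k * y ∣ < ∣ y ∣ → k ≡ + 0
∣k*y∣<∣y∣⇒k≡0 (+ zero)  y _  = refl
∣k*y∣<∣y∣⇒k≡0 (+ suc n) y lt =
  contradiction (subst (_< ∣ y ∣) (ℤₚ.abs-* (+ suc n) y) lt) (ℕₚ.≤⇒≯ (m≤n*m′ ∣ y ∣ {suc n} (s≤s z≤n)))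
∣k*y∣<∣y∣⇒k≡0 -[1+ n ]  y lt =
  contradiction (subst (_< ∣ y ∣) (ℤₚ.abs-* -[1+ n ] y) lt) (ℕₚ.≤⇒≯ (m≤n*m′ ∣ y ∣ {suc n} (s≤s z≤n)))

∣m-n∣<o : ∀ {m n o} → m < o → n < o → ∣ + m - + n ∣ < o
∣m-n∣<o {m} {n} m<o n<o rewrite ℤₚ.m-n≡m⊖n m n with ℕₚ.≤-total n m
... | inj₁ n≤m rewrite ℤₚ.⊖-≥ n≤m = ℕₚ.≤-<-trans (ℕₚ.m∸n≤m m n) m<o
... | inj₂ m≤n rewrite ℤₚ.∣m⊖n∣≡∣n⊖m∣ m n | ℤₚ.⊖-≥ m≤n = ℕₚ.≤-<-trans (ℕₚ.m∸n≤m n m) n<o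

same-residue : ∀ a b y q r → a + q * y ≡ b + r * y → a - b ≡ (r - q) * y
same-residue a b y q r eq = begin
  a - b                   ≡⟨ expand a b q y ⟩
  (a + q * y) - b - q * y ≡⟨ cong (λ t → t - b - q * y) eq ⟩
  (b + r * y) - b - q * y ≡⟨ collect b r q y ⟩
  (r - q) * y             ∎
  where
  open ≡-Reasoning
  expand : ∀ a b q y → a - b ≡ (a + q * y) - b - q * y
  expand = solve-∀
  collect : ∀ b r q y → (b + r * y) - b - q * y ≡ (r - q) * y
  collect = solve-∀

%-unique : ∀ v y .{{_ : NonZero y}} {r} q → v ≡ + r + q * y → r < ∣ y ∣ → + (v % y) ≡ + r
%-unique v y {r} q eq r<y =
  ℤₚ.i-j≡0⇒i≡j _ _ (trans [v%y]-r≡ (trans (cong (_* y) q-v/y≡0) (ℤₚ.*-zeroˡ y)))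
  where
  [v%y]-r≡ : + (v % y) - + r ≡ (q - v / y) * y
  [v%y]-r≡ = same-residue (+ (v % y)) (+ r) y (v / y) q (trans (sym (a≡a%n+[a/n]*n v y)) eq)
  q-v/y≡0 : q - v / y ≡ + 0
  q-v/y≡0 = ∣k*y∣<∣y∣⇒k≡0 (q - v / y) y
    (subst (λ t → ∣ t ∣ < ∣ y ∣) [v%y]-r≡ (∣m-n∣<o (n%d<d v y) r<y))

modℤ-unique : ∀ v y {r} q → v ≡ + r + q * y → r < ∣ y ∣ → modℤ v y ≡ + r
modℤ-unique v (+ zero)    q _  ()
modℤ-unique v (+ suc n)   q eq r<y = %-unique v (+ suc n) q eq r<y
modℤ-unique v (-[1+ n ])  q eq r<y = %-unique v -[1+ n ] q eq r<y

-- Coefficient lists and Horner sums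

sumℤ-++ : ∀ xs ys → sumℤ (xs ++ ys) ≡ sumℤ xs + sumℤ ys
sumℤ-++ []       ys = sym (ℤₚ.+-identityˡ (sumℤ ys))
sumℤ-++ (x ∷ xs) ys = trans (cong (_+_ x) (sumℤ-++ xs ys)) (sym (ℤₚ.+-assoc x (sumℤ xs) (sumℤ ys)))

sumℤ-upTo-suc : ∀ f t → sumℤ (map f (upTo (suc t))) ≡ sumℤ (map f (upTo t)) + f t
sumℤ-upTo-suc f t = begin
  sumℤ (map f (upTo (suc t)))               ≡⟨ cong (sumℤ ∘ map f) (sym (Listₚ.upTo-∷ʳ t)) ⟩
  sumℤ (map f (upTo t ++ t ∷ []))           ≡⟨ cong sumℤ (Listₚ.map-++ f (upTo t) (t ∷ [])) ⟩
  sumℤ (map f (upTo t) ++ f t ∷ [])         ≡⟨ sumℤ-++ (map f (upTo t)) (f t ∷ []) ⟩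
  sumℤ (map f (upTo t)) + (f t + + 0)       ≡⟨ cong (_+_ (sumℤ (map f (upTo t)))) (ℤₚ.+-identityʳ (f t)) ⟩
  sumℤ (map f (upTo t)) + f t               ∎
  where open ≡-Reasoning

∣sumℤ∣≤∑∣∣ : ∀ t f → ∣ sumℤ (map f (upTo t)) ∣ ≤ ∑ t (∣_∣ ∘ f)
∣sumℤ∣≤∑∣∣ zero    f = z≤n
∣sumℤ∣≤∑∣∣ (suc t) f rewrite sumℤ-upTo-suc f t =
  ℕₚ.≤-trans (ℤₚ.∣i+j∣≤∣i∣+∣j∣ (sumℤ (map f (upTo t))) (f t))
             (ℕₚ.+-monoˡ-≤ ∣ f t ∣ (∣sumℤ∣≤∑∣∣ t f))

eval-⊕ : ∀ p q x → eval (p ⊕ q) x ≡ eval p x + eval q x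
eval-⊕ []      q       x = sym (ℤₚ.+-identityˡ (eval q x))
eval-⊕ (a ∷ p) []      x = sym (ℤₚ.+-identityʳ (eval (a ∷ p) x))
eval-⊕ (a ∷ p) (b ∷ q) x =
  trans (cong (λ v → a + b + x * v) (eval-⊕ p q x)) (interchange a b x (eval p x) (eval q x))
  where
  interchange : ∀ a b x u v → a + b + x * (u + v) ≡ (a + x * u) + (b + x * v)
  interchange = solve-∀

eval-· : ∀ c p x → eval (c · p) x ≡ c * eval p x
eval-· c []      x = sym (ℤₚ.*-zeroʳ c)
eval-· c (a ∷ p) x =
  trans (cong (λ v → c * a + x * v) (eval-· c p x)) (factor c a x (eval p x))
  where
  factor : ∀ c a x u → c * a + x * (c * u) ≡ c * (a + x * u)
  factor = solve-∀

eval-⊗ : ∀ p q x → eval (p ⊗ q) x ≡ eval p x * eval q x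
eval-⊗ []      q x = refl
eval-⊗ (a ∷ p) q x = begin
  eval ((a · q) ⊕ (+ 0 ∷ (p ⊗ q))) x
    ≡⟨ eval-⊕ (a · q) (+ 0 ∷ (p ⊗ q)) x ⟩
  eval (a · q) x + (+ 0 + x * eval (p ⊗ q) x)
    ≡⟨ cong₂ (λ u v → u + (+ 0 + x * v)) (eval-· a q x) (eval-⊗ p q x) ⟩
  a * eval q x + (+ 0 + x * (eval p x * eval q x))
    ≡⟨ factor a x (eval p x) (eval q x) ⟩
  (a + x * eval p x) * eval q x
    ∎
  where
  open ≡-Reasoning
  factor : ∀ a x u v → a * v + (+ 0 + x * (u * v)) ≡ (a + x * u) * v
  factor = solve-∀

private
  shift-distrib : ∀ a x u xk v → a + x * (u + xk * v) ≡ a + x * u + x * xk * v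
  shift-distrib = solve-∀

  0+1*v≡v : ∀ v → + 0 + + 1 * v ≡ v
  0+1*v≡v = solve-∀

eval-++ : ∀ p q x → eval (p ++ q) x ≡ eval p x + x ^ length p * eval q x
eval-++ []      q x = sym (0+1*v≡v (eval q x))
eval-++ (a ∷ p) q x =
  trans (cong (λ v → a + x * v) (eval-++ p q x)) (shift-distrib a x (eval p x) (x ^ length p) (eval q x))

eval-take-drop : ∀ k p x → eval p x ≡ eval (take k p) x + x ^ k * eval (drop k p) x
eval-take-drop zero    p       x = sym (0+1*v≡v (eval p x))
eval-take-drop (suc k) []      x = sym (trans (ℤₚ.+-identityˡ _) (ℤₚ.*-zeroʳ (x ^ suc k)))
eval-take-drop (suc k) (a ∷ p) x =
  trans (cong (λ v → a + x * v) (eval-take-drop k p x))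
        (shift-distrib a x (eval (take k p) x) (x ^ k) (eval (drop k p) x))

‖_‖ : Poly → ℕ
‖ []    ‖ = 0
‖ a ∷ p ‖ = ∣ a ∣ ℕ.+ ‖ p ‖

∣eval-take∣≤ : ∀ k p x → 1 ≤ ∣ x ∣ → ∣ eval (take (suc k) p) x ∣ ≤ ‖ p ‖ ℕ.* ∣ x ∣ ℕ.^ k
∣eval-take∣≤ k       []      x _ = z≤n
∣eval-take∣≤ zero    (a ∷ p) x _
  rewrite ℤₚ.*-zeroʳ x | ℤₚ.+-identityʳ a | ℕₚ.*-identityʳ (∣ a ∣ ℕ.+ ‖ p ‖) = ℕₚ.m≤m+n ∣ a ∣ ‖ p ‖
∣eval-take∣≤ (suc k) (a ∷ p) x x≥1 = begin
  ∣ a + x * eval (take (suc k) p) x ∣          ≤⟨ ℤₚ.∣i+j∣≤∣i∣+∣j∣ a _ ⟩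
  ∣ a ∣ ℕ.+ ∣ x * eval (take (suc k) p) x ∣    ≡⟨ cong (ℕ._+_ ∣ a ∣) (ℤₚ.abs-* x _) ⟩
  ∣ a ∣ ℕ.+ X ℕ.* ∣ eval (take (suc k) p) x ∣  ≤⟨ ℕₚ.+-mono-≤ (m≤m*n′ ∣ a ∣ (1≤m^n (suc k) x≥1))
                                                                (ℕₚ.*-monoʳ-≤ X (∣eval-take∣≤ k p x x≥1)) ⟩
  ∣ a ∣ ℕ.* X ℕ.^ suc k ℕ.+ X ℕ.* (‖ p ‖ ℕ.* X ℕ.^ k) ≡⟨ regroup ∣ a ∣ ‖ p ‖ X (X ℕ.^ k) ⟩
  (∣ a ∣ ℕ.+ ‖ p ‖) ℕ.* X ℕ.^ suc k             ∎
  where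
  open ℕₚ.≤-Reasoning
  X = ∣ x ∣
  regroup : ∀ a n X Xᵏ → a ℕ.* (X ℕ.* Xᵏ) ℕ.+ X ℕ.* (n ℕ.* Xᵏ) ≡ (a ℕ.+ n) ℕ.* (X ℕ.* Xᵏ)
  regroup = ℕ-Solver.solve-∀

horner : ℤ → (ℕ → ℤ) → ℕ → ℤ
horner x f zero    = + 0
horner x f (suc k) = x * horner x f k + f k

eval-applyUpTo-∸ : ∀ (f : ℕ → ℤ) k x → eval (applyUpTo (λ j → f (k ℕ.∸ j)) k) x ≡ horner x (f ∘ suc) k
eval-applyUpTo-∸ f zero    x = refl
eval-applyUpTo-∸ f (suc k) x = begin
  f (suc k) + x * eval (applyUpTo (λ j → f (k ℕ.∸ j)) k) x
    ≡⟨ cong (λ h → f (suc k) + x * h) (eval-applyUpTo-∸ f k x) ⟩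
  f (suc k) + x * horner x (f ∘ suc) k
    ≡⟨ ℤₚ.+-comm (f (suc k)) (x * horner x (f ∘ suc) k) ⟩
  x * horner x (f ∘ suc) k + f (suc k)
    ∎
  where open ≡-Reasoning

∣horner∣≤ : ∀ x f {E} k → 1 ≤ ∣ x ∣ → (∀ {t} → t ≤ k → ∣ f t ∣ ≤ E) →
            ∣ horner x f (suc k) ∣ ≤ suc k ℕ.* E ℕ.* ∣ x ∣ ℕ.^ k
∣horner∣≤ x f {E} zero _ f≤E rewrite ℤₚ.*-zeroʳ x | ℤₚ.+-identityˡ (f 0) =
  ℕₚ.≤-trans (f≤E z≤n) (ℕₚ.≤-reflexive (E≡1*E*1 E))
  where
  E≡1*E*1 : ∀ E → E ≡ 1 ℕ.* E ℕ.* 1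
  E≡1*E*1 = ℕ-Solver.solve-∀
∣horner∣≤ x f {E} (suc k) x≥1 f≤E = begin
  ∣ x * horner x f (suc k) + f (suc k) ∣          ≤⟨ ℤₚ.∣i+j∣≤∣i∣+∣j∣ (x * horner x f (suc k)) _ ⟩
  ∣ x * horner x f (suc k) ∣ ℕ.+ ∣ f (suc k) ∣    ≡⟨ cong (ℕ._+ ∣ f (suc k) ∣) (ℤₚ.abs-* x _) ⟩
  X ℕ.* ∣ horner x f (suc k) ∣ ℕ.+ ∣ f (suc k) ∣  ≤⟨ ℕₚ.+-mono-≤
      (ℕₚ.*-monoʳ-≤ X (∣horner∣≤ x f k x≥1 (f≤E ∘ ℕₚ.m≤n⇒m≤1+n)))
      (ℕₚ.≤-trans (f≤E ℕₚ.≤-refl) (m≤m*n′ E (1≤m^n (suc k) x≥1))) ⟩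
  X ℕ.* (suc k ℕ.* E ℕ.* X ℕ.^ k) ℕ.+ E ℕ.* X ℕ.^ suc k ≡⟨ regroup X k E (X ℕ.^ k) ⟩
  suc (suc k) ℕ.* E ℕ.* X ℕ.^ suc k              ∎
  where
  open ℕₚ.≤-Reasoning
  X = ∣ x ∣
  regroup : ∀ X k E Xᵏ →
            X ℕ.* (suc k ℕ.* E ℕ.* Xᵏ) ℕ.+ E ℕ.* (X ℕ.* Xᵏ) ≡ suc (suc k) ℕ.* E ℕ.* (X ℕ.* Xᵏ)
  regroup = ℕ-Solver.solve-∀

-- Linear recurrences

recSum-suc : ∀ t α s m → recSum (suc t) α s m ≡ recSum t α s (suc m) + α (suc t) * + s m
recSum-suc t α s m = begin
  sumℤ (map term (upTo (suc t)))
    ≡⟨ sumℤ-upTo-suc term t ⟩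
  sumℤ (map term (upTo t)) + term t
    ≡⟨ cong₂ _+_ (cong sumℤ (Listₚ.map-cong shift (upTo t)))
                 (cong (λ j → α (suc t) * + s j) (ℕₚ.m+n∸n≡m m (suc t))) ⟩
  recSum t α s (suc m) + α (suc t) * + s m
    ∎
  where
  open ≡-Reasoning
  term : ℕ → ℤ
  term i = α (suc i) * + s (m ℕ.+ suc t ℕ.∸ suc i)
  shift : ∀ i → term i ≡ α (suc i) * + s (suc m ℕ.+ t ℕ.∸ suc i)
  shift i = cong (λ j → α (suc i) * + s (j ℕ.∸ suc i)) (ℕₚ.+-suc m t)

module Recurrence (d₁ : ℕ) (α : ℕ → ℤ) (s : ℕ → ℕ)
                  (rec : ∀ n → + s (n ℕ.+ suc d₁) + recSum (suc d₁) α s n ≡ + 0) where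

  d : ℕ
  d = suc d₁

  partialSum : ℕ → ℕ → ℤ
  partialSum m zero    = + s m
  partialSum m (suc t) = partialSum (suc m) t + α (suc t) * + s m

  partialSum≡s+recSum : ∀ m t → partialSum m t ≡ + s (m ℕ.+ t) + recSum t α s m
  partialSum≡s+recSum m zero    = trans (cong (+_ ∘ s) (sym (ℕₚ.+-identityʳ m))) (sym (ℤₚ.+-identityʳ _))
  partialSum≡s+recSum m (suc t) = begin
    partialSum (suc m) t + α (suc t) * + s m
      ≡⟨ cong (_+ α (suc t) * + s m) (partialSum≡s+recSum (suc m) t) ⟩
    + s (suc m ℕ.+ t) + recSum t α s (suc m) + α (suc t) * + s m
      ≡⟨ ℤₚ.+-assoc (+ s (suc m ℕ.+ t)) (recSum t α s (suc m)) (α (suc t) * + s m) ⟩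
    + s (suc m ℕ.+ t) + (recSum t α s (suc m) + α (suc t) * + s m)
      ≡⟨ cong₂ (λ j r → + s j + r) (sym (ℕₚ.+-suc m t)) (sym (recSum-suc t α s m)) ⟩
    + s (m ℕ.+ suc t) + recSum (suc t) α s m
      ∎
    where open ≡-Reasoning

  partialSum-d : ∀ m → partialSum m d ≡ + 0
  partialSum-d m = trans (partialSum≡s+recSum m d) (rec m)

  partialSum-last : ∀ n → partialSum (suc n) d₁ ≡ - (α d * + s n)
  partialSum-last n = i+j≡0⇒i≡-j _ (α d * + s n) (partialSum-d n)

  ‖α‖ M K : ℕ
  ‖α‖ = ∑ d (λ i → ∣ α (suc i) ∣)
  M   = suc ‖α‖
  K   = suc (∑ d s)

  P : ℕ → ℕ
  P j = K ℕ.* M ℕ.^ j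

  P-mono : ∀ {i j} → i ≤ j → P i ≤ P j
  P-mono i≤j = ℕₚ.*-monoʳ-≤ K (^-monoʳ-≤′ (s≤s z≤n) i≤j)

  P-suc : ∀ j → M ℕ.* P j ≡ P (suc j)
  P-suc j = swap M K (M ℕ.^ j)
    where
    swap : ∀ a b c → a ℕ.* (b ℕ.* c) ≡ b ℕ.* (a ℕ.* c)
    swap = ℕ-Solver.solve-∀

  ∣α∣≤‖α‖ : ∀ {t} → t < d → ∣ α (suc t) ∣ ≤ ‖α‖
  ∣α∣≤‖α‖ = term≤∑ (λ i → ∣ α (suc i) ∣)

  private
    index≤ : ∀ m i → m ℕ.+ d ℕ.∸ suc i ≤ m ℕ.+ d₁
    index≤ m i rewrite ℕₚ.+-suc m d₁ = ℕₚ.m∸n≤m (m ℕ.+ d₁) i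

    index< : ∀ m i → m ℕ.+ d ℕ.∸ suc i < m ℕ.+ d
    index< m i = subst (m ℕ.+ d ℕ.∸ suc i <_) (sym (ℕₚ.+-suc m d₁)) (s≤s (index≤ m i))

  s-step : ∀ m → (∀ {i} → i < m ℕ.+ d → s i ≤ P i) → s (m ℕ.+ d) ≤ P (m ℕ.+ d)
  s-step m IH = begin
    ∣ + s (m ℕ.+ d) ∣                           ≡⟨ cong ∣_∣ s[m+d]≡-recSum ⟩
    ∣ - recSum d α s m ∣                        ≡⟨ ℤₚ.∣-i∣≡∣i∣ (recSum d α s m) ⟩
    ∣ recSum d α s m ∣                          ≤⟨ ∣sumℤ∣≤∑∣∣ d term ⟩
    ∑ d (∣_∣ ∘ term)                            ≤⟨ ∑-mono-≤ d ∣term∣≤ ⟩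
    ∑ d (λ i → ∣ α (suc i) ∣ ℕ.* P (m ℕ.+ d₁))  ≡⟨ ∑-distribʳ-* d (∣_∣ ∘ α ∘ suc) (P (m ℕ.+ d₁)) ⟩
    ‖α‖ ℕ.* P (m ℕ.+ d₁)                        ≤⟨ ℕₚ.*-monoˡ-≤ (P (m ℕ.+ d₁)) (ℕₚ.n≤1+n ‖α‖) ⟩
    M ℕ.* P (m ℕ.+ d₁)                          ≡⟨ P-suc (m ℕ.+ d₁) ⟩
    P (suc (m ℕ.+ d₁))                          ≡⟨ cong P (sym (ℕₚ.+-suc m d₁)) ⟩
    P (m ℕ.+ d)                                 ∎
    where
    open ℕₚ.≤-Reasoning
    s[m+d]≡-recSum : + s (m ℕ.+ d) ≡ - recSum d α s m
    s[m+d]≡-recSum = i+j≡0⇒i≡-j _ _ (rec m)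
    term : ℕ → ℤ
    term i = α (suc i) * + s (m ℕ.+ d ℕ.∸ suc i)
    ∣term∣≤ : ∀ i → ∣ term i ∣ ≤ ∣ α (suc i) ∣ ℕ.* P (m ℕ.+ d₁)
    ∣term∣≤ i = ℕₚ.≤-trans (ℕₚ.≤-reflexive (ℤₚ.abs-* (α (suc i)) _))
      (ℕₚ.*-monoʳ-≤ ∣ α (suc i) ∣ (ℕₚ.≤-trans (IH (index< m i)) (P-mono (index≤ m i))))

  s≤P : ∀ j → s j ≤ P j
  s≤P = <-rec (λ j → s j ≤ P j) step
    where
    step : ∀ j → (∀ {i} → i < j → s i ≤ P i) → s j ≤ P j
    step j IH with j ℕ.<? d
    ... | yes j<d = ℕₚ.≤-trans (ℕₚ.≤-trans (term≤∑ s j<d) (ℕₚ.n≤1+n _)) (m≤m*n′ K (1≤m^n j (s≤s z≤n)))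
    ... | no  j≮d = subst (λ k → s k ≤ P k) m+d≡j (s-step m (IH ∘ subst (_ <_) m+d≡j))
      where
      m = j ℕ.∸ d
      m+d≡j : m ℕ.+ d ≡ j
      m+d≡j = ℕₚ.m∸n+n≡m (ℕₚ.≮⇒≥ j≮d)

  ∣partialSum∣≤ : ∀ m t → t ≤ d → ∣ partialSum m t ∣ ≤ suc t ℕ.* P (m ℕ.+ t)
  ∣partialSum∣≤ m zero    _ rewrite ℕₚ.+-identityʳ m | ℕₚ.*-identityˡ (P m) = s≤P m
  ∣partialSum∣≤ m (suc t) t<d = begin
    ∣ partialSum (suc m) t + α (suc t) * + s m ∣
      ≤⟨ ℤₚ.∣i+j∣≤∣i∣+∣j∣ (partialSum (suc m) t) (α (suc t) * + s m) ⟩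
    ∣ partialSum (suc m) t ∣ ℕ.+ ∣ α (suc t) * + s m ∣
      ≡⟨ cong (ℕ._+_ ∣ partialSum (suc m) t ∣) (ℤₚ.abs-* (α (suc t)) (+ s m)) ⟩
    ∣ partialSum (suc m) t ∣ ℕ.+ ∣ α (suc t) ∣ ℕ.* s m
      ≤⟨ ℕₚ.+-mono-≤ (∣partialSum∣≤ (suc m) t (ℕₚ.<⇒≤ t<d))
                     (ℕₚ.*-mono-≤ (ℕₚ.m≤n⇒m≤1+n (∣α∣≤‖α‖ t<d)) (s≤P m)) ⟩
    suc t ℕ.* P (suc m ℕ.+ t) ℕ.+ M ℕ.* P m
      ≡⟨ cong₂ (λ j p → suc t ℕ.* P j ℕ.+ p) (sym (ℕₚ.+-suc m t)) (P-suc m) ⟩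
    suc t ℕ.* P (m ℕ.+ suc t) ℕ.+ P (suc m)
      ≤⟨ ℕₚ.+-monoʳ-≤ (suc t ℕ.* P (m ℕ.+ suc t))
                      (P-mono (subst (suc m ≤_) (sym (ℕₚ.+-suc m t)) (s≤s (ℕₚ.m≤m+n m t)))) ⟩
    suc t ℕ.* P (m ℕ.+ suc t) ℕ.+ P (m ℕ.+ suc t)
      ≡⟨ ℕₚ.+-comm (suc t ℕ.* P (m ℕ.+ suc t)) (P (m ℕ.+ suc t)) ⟩
    suc (suc t) ℕ.* P (m ℕ.+ suc t)
      ∎
    where open ℕₚ.≤-Reasoning

  ∣partialSum∣≤d*P : ∀ m {t} → t < d → ∣ partialSum m t ∣ ≤ d ℕ.* P (m ℕ.+ d)
  ∣partialSum∣≤d*P m {t} t<d = ℕₚ.≤-trans (∣partialSum∣≤ m t (ℕₚ.<⇒≤ t<d))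
    (ℕₚ.*-mono-≤ t<d (P-mono (ℕₚ.+-monoʳ-≤ m (ℕₚ.<⇒≤ t<d))))

  module Evaluation (x : ℤ) where

    G : ℕ → ℤ
    G = horner x (α ∘ suc)

    B : ℕ → ℤ
    B k = x ^ k + G k

    -- S m is S_{m-1}(x) = s(m-1) + s(m-2) x + … + s(0) x^(m-1)
    S : ℕ → ℤ
    S = horner x (+_ ∘ s)

    H : ℕ → ℕ → ℤ
    H m = horner x (partialSum m)

    H-step : ∀ m k → x * H m k + partialSum m k ≡ H (suc m) k + B k * + s m
    H-step m zero    = base x (+ s m)
      where
      base : ∀ x σ → x * + 0 + σ ≡ + 0 + (+ 1 + + 0) * σ
      base = solve-∀
    H-step m (suc k) = begin
      x * (x * H m k + partialSum m k) + (partialSum (suc m) k + α (suc k) * + s m)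
        ≡⟨ cong (λ h → x * h + (partialSum (suc m) k + α (suc k) * + s m)) (H-step m k) ⟩
      x * (H (suc m) k + (x ^ k + G k) * + s m) + (partialSum (suc m) k + α (suc k) * + s m)
        ≡⟨ regroup x (H (suc m) k) (x ^ k) (G k) (+ s m) (partialSum (suc m) k) (α (suc k)) ⟩
      (x * H (suc m) k + partialSum (suc m) k) + (x * x ^ k + (x * G k + α (suc k))) * + s m
        ∎
      where
      open ≡-Reasoning
      regroup : ∀ x h xᵏ g σ p a →
                x * (h + (xᵏ + g) * σ) + (p + a * σ) ≡ (x * h + p) + (x * xᵏ + (x * g + a)) * σ
      regroup = solve-∀

    x^m*H₀≡B*S+H : ∀ m → x ^ m * H 0 d ≡ B d * S m + H m d
    x^m*H₀≡B*S+H zero    = base (B d) (H 0 d)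
      where
      base : ∀ b h → + 1 * h ≡ b * + 0 + h
      base = solve-∀
    x^m*H₀≡B*S+H (suc m) = begin
      x * x ^ m * H 0 d                              ≡⟨ ℤₚ.*-assoc x (x ^ m) (H 0 d) ⟩
      x * (x ^ m * H 0 d)                            ≡⟨ cong (x *_) (x^m*H₀≡B*S+H m) ⟩
      x * (B d * S m + H m d)                        ≡⟨ distrib x (B d) (S m) (H m d) ⟩
      B d * (x * S m) + (x * H m d + + 0)            ≡⟨ cong (λ p → B d * (x * S m) + (x * H m d + p))
                                                             (sym (partialSum-d m)) ⟩
      B d * (x * S m) + (x * H m d + partialSum m d) ≡⟨ cong (λ h → B d * (x * S m) + h) (H-step m d) ⟩
      B d * (x * S m) + (H (suc m) d + B d * + s m)  ≡⟨ collect (B d) (x * S m) (H (suc m) d) (+ s m) ⟩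
      B d * (x * S m + + s m) + H (suc m) d          ∎
      where
      open ≡-Reasoning
      distrib : ∀ x b σ h → x * (b * σ + h) ≡ b * (x * σ) + (x * h + + 0)
      distrib = solve-∀
      collect : ∀ b xσ h σ → b * xσ + (h + b * σ) ≡ b * (xσ + σ) + h
      collect = solve-∀

    eval-Bpoly : eval (Bpoly d α) x ≡ B d
    eval-Bpoly = begin
      eval (coeffs ++ + 1 ∷ []) x
        ≡⟨ eval-++ coeffs (+ 1 ∷ []) x ⟩
      eval coeffs x + x ^ length coeffs * (+ 1 + x * + 0)
        ≡⟨ cong₂ (λ p n → eval p x + x ^ n * (+ 1 + x * + 0)) (Listₚ.map-upTo (λ k → α (d ℕ.∸ k)) d) length-coeffs ⟩
      eval (applyUpTo (λ k → α (d ℕ.∸ k)) d) x + x ^ d * (+ 1 + x * + 0)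
        ≡⟨ cong (λ g → g + x ^ d * (+ 1 + x * + 0)) (eval-applyUpTo-∸ α d x) ⟩
      G d + x ^ d * (+ 1 + x * + 0)
        ≡⟨ simplify (G d) (x ^ d) x ⟩
      x ^ d + G d
        ∎
      where
      open ≡-Reasoning
      coeffs = map (λ k → α (d ℕ.∸ k)) (upTo d)
      length-coeffs : length coeffs ≡ d
      length-coeffs = trans (Listₚ.length-map (λ k → α (d ℕ.∸ k)) (upTo d)) (Listₚ.length-upTo d)
      simplify : ∀ g xᵈ x → g + xᵈ * (+ 1 + x * + 0) ≡ xᵈ + g
      simplify = solve-∀

    eval-Spoly : eval (Spoly d s) x ≡ S d
    eval-Spoly = begin
      eval (map (λ k → + s (d ℕ.∸ 1 ℕ.∸ k)) (upTo d)) x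
        ≡⟨ cong (λ p → eval p x) (Listₚ.map-cong reindex (upTo d)) ⟩
      eval (map (λ k → + s (ℕ.pred (d ℕ.∸ k))) (upTo d)) x
        ≡⟨ cong (λ p → eval p x) (Listₚ.map-upTo (λ k → + s (ℕ.pred (d ℕ.∸ k))) d) ⟩
      eval (applyUpTo (λ k → + s (ℕ.pred (d ℕ.∸ k))) d) x
        ≡⟨ eval-applyUpTo-∸ (+_ ∘ s ∘ ℕ.pred) d x ⟩
      S d
        ∎
      where
      open ≡-Reasoning
      reindex : ∀ k → + s (d ℕ.∸ 1 ℕ.∸ k) ≡ + s (ℕ.pred (d ℕ.∸ k))
      reindex k = cong (+_ ∘ s) (trans (ℕₚ.∸-+-assoc d 1 k) (sym (ℕₚ.pred[m∸n]≡m∸[1+n] d k)))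

    low : ℤ
    low = eval (take d (Bpoly d α ⊗ Spoly d s)) x

    B*S≡low+x^d*A : B d * S d ≡ low + x ^ d * eval (Apoly d α s) x
    B*S≡low+x^d*A = begin
      B d * S d                                ≡⟨ sym (cong₂ _*_ eval-Bpoly eval-Spoly) ⟩
      eval (Bpoly d α) x * eval (Spoly d s) x  ≡⟨ sym (eval-⊗ (Bpoly d α) (Spoly d s) x) ⟩
      eval (Bpoly d α ⊗ Spoly d s) x           ≡⟨ eval-take-drop d (Bpoly d α ⊗ Spoly d s) x ⟩
      low + x ^ d * eval (Apoly d α s) x       ∎
      where open ≡-Reasoning

    [H₀-A]*x^d≡low+H : (H 0 d - eval (Apoly d α s) x) * x ^ d ≡ low + H d d
    [H₀-A]*x^d≡low+H = begin
      (H 0 d - A) * x ^ d                 ≡⟨ expand (H 0 d) A (x ^ d) ⟩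
      x ^ d * H 0 d - x ^ d * A           ≡⟨ cong (_- x ^ d * A) (x^m*H₀≡B*S+H d) ⟩
      B d * S d + H d d - x ^ d * A       ≡⟨ cong (λ t → t + H d d - x ^ d * A) B*S≡low+x^d*A ⟩
      low + x ^ d * A + H d d - x ^ d * A ≡⟨ cancel low (x ^ d * A) (H d d) ⟩
      low + H d d                         ∎
      where
      open ≡-Reasoning
      A = eval (Apoly d α s) x
      expand : ∀ h a y → (h - a) * y ≡ y * h - y * a
      expand = solve-∀
      cancel : ∀ c xa h → c + xa + h - xa ≡ c + h
      cancel = solve-∀

-- Extracting s(n) from the numerator

module LastDigit (d₂ : ℕ) (α : ℕ → ℤ) (s : ℕ → ℕ)
                 (rec : ∀ n → + s (n ℕ.+ suc (suc d₂)) + recSum (suc (suc d₂)) α s n ≡ + 0)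
                 (αd≢0 : α (suc (suc d₂)) ≢ + 0) where

  d₁ : ℕ
  d₁ = suc d₂

  open Recurrence d₁ α s rec public

  ‖B⊗S‖ L : ℕ
  ‖B⊗S‖ = ‖ Bpoly d α ⊗ Spoly d s ‖
  L     = d ℕ.* d ℕ.* K ℕ.* M ℕ.^ d

  HB : ℕ → ℕ
  HB m = L ℕ.* M ℕ.^ m

  d*[d*P]≡HB : ∀ m → d ℕ.* (d ℕ.* P (m ℕ.+ d)) ≡ HB m
  d*[d*P]≡HB m = trans (cong (λ p → d ℕ.* (d ℕ.* (K ℕ.* p))) (ℕₚ.^-distribˡ-+-* M m d))
                       (regroup d K (M ℕ.^ m) (M ℕ.^ d))
    where
    regroup : ∀ d K Mᵐ Mᵈ → d ℕ.* (d ℕ.* (K ℕ.* (Mᵐ ℕ.* Mᵈ))) ≡ d ℕ.* d ℕ.* K ℕ.* Mᵈ ℕ.* Mᵐ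
    regroup = ℕ-Solver.solve-∀

  P≤HB : ∀ m → P m ≤ HB m
  P≤HB m = ℕₚ.*-monoˡ-≤ (M ℕ.^ m) K≤L
    where
    K≤L : K ≤ L
    K≤L = ℕₚ.≤-trans (m≤n*m′ K {d ℕ.* d} (s≤s z≤n)) (m≤m*n′ (d ℕ.* d ℕ.* K) (1≤m^n d (s≤s z≤n)))

  module Digits (b n : ℕ)
                (X-large : ‖B⊗S‖ ℕ.+ HB d < b ℕ.^ n)
                (Y-large : HB (suc n) < b ℕ.^ ⌈ n /2⌉)
                (X-room  : b ℕ.^ ⌈ n /2⌉ ℕ.+ b ℕ.^ ⌈ n /2⌉ ℕ.+ d ℕ.* ‖α‖ ≤ b ℕ.^ n) where

    X Y : ℕ
    X = b ℕ.^ n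
    Y = b ℕ.^ ⌈ n /2⌉

    x : ℤ
    x = + X

    open Evaluation x

    T : ℕ
    T = X ℕ.^ d₁ ℕ.* Y

    sg : ℤ
    sg = sgn (α d)

    1≤X : 1 ≤ X
    1≤X = ℕₚ.≤-trans (s≤s z≤n) X-large

    ∣x^d∣≡ : ∣ x ^ d ∣ ≡ X ℕ.* X ℕ.^ d₁
    ∣x^d∣≡ = cong ∣_∣ (pos-^ X d)

    ∣H∣≤ : ∀ m → ∣ H m d ∣ ≤ HB m ℕ.* X ℕ.^ d₁
    ∣H∣≤ m = subst (λ c → ∣ H m d ∣ ≤ c ℕ.* X ℕ.^ d₁) (d*[d*P]≡HB m)
                   (∣horner∣≤ x (partialSum m) d₁ 1≤X (λ t≤d₁ → ∣partialSum∣≤d*P m (s≤s t≤d₁)))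

    ∣G∣≤ : ∣ G d ∣ ≤ d ℕ.* ‖α‖ ℕ.* X ℕ.^ d₁
    ∣G∣≤ = ∣horner∣≤ x (α ∘ suc) d₁ 1≤X (λ t≤d₁ → ∣α∣≤‖α‖ (s≤s t≤d₁))

    ∣low+H∣<∣x^d∣ : ∣ low + H d d ∣ < ∣ x ^ d ∣
    ∣low+H∣<∣x^d∣ = begin-strict
      ∣ low + H d d ∣                            ≤⟨ ℤₚ.∣i+j∣≤∣i∣+∣j∣ low (H d d) ⟩
      ∣ low ∣ ℕ.+ ∣ H d d ∣                      ≤⟨ ℕₚ.+-mono-≤ (∣eval-take∣≤ d₁ (Bpoly d α ⊗ Spoly d s) x 1≤X)
                                                                (∣H∣≤ d) ⟩
      ‖B⊗S‖ ℕ.* X ℕ.^ d₁ ℕ.+ HB d ℕ.* X ℕ.^ d₁  ≡⟨ sym (ℕₚ.*-distribʳ-+ (X ℕ.^ d₁) ‖B⊗S‖ (HB d)) ⟩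
      (‖B⊗S‖ ℕ.+ HB d) ℕ.* X ℕ.^ d₁             <⟨ *-monoˡ-<′ (X ℕ.^ d₁) (1≤m^n d₁ 1≤X) X-large ⟩
      X ℕ.* X ℕ.^ d₁                             ≡⟨ sym ∣x^d∣≡ ⟩
      ∣ x ^ d ∣                                  ∎
      where open ℕₚ.≤-Reasoning

    eval-Apoly : eval (Apoly d α s) x ≡ H 0 d
    eval-Apoly = sym (ℤₚ.i-j≡0⇒i≡j (H 0 d) (eval (Apoly d α s) x) H₀-A≡0)
      where
      H₀-A≡0 : H 0 d - eval (Apoly d α s) x ≡ + 0
      H₀-A≡0 = ∣k*y∣<∣y∣⇒k≡0 _ (x ^ d)
        (subst (λ t → ∣ t ∣ < ∣ x ^ d ∣) (sym [H₀-A]*x^d≡low+H) ∣low+H∣<∣x^d∣)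

    w : ℤ
    w = sg * H (suc n) d

    ∣w∣<T : ∣ w ∣ < T
    ∣w∣<T = begin-strict
      ∣ sg * H (suc n) d ∣              ≡⟨ ℤₚ.abs-* sg (H (suc n) d) ⟩
      ∣ sg ∣ ℕ.* ∣ H (suc n) d ∣        ≡⟨ cong (ℕ._* ∣ H (suc n) d ∣) (sgn-abs (α d)) ⟩
      1 ℕ.* ∣ H (suc n) d ∣             ≡⟨ ℕₚ.*-identityˡ ∣ H (suc n) d ∣ ⟩
      ∣ H (suc n) d ∣                   ≤⟨ ∣H∣≤ (suc n) ⟩
      HB (suc n) ℕ.* X ℕ.^ d₁           <⟨ *-monoˡ-<′ (X ℕ.^ d₁) (1≤m^n d₁ 1≤X) Y-large ⟩
      Y ℕ.* X ℕ.^ d₁                    ≡⟨ ℕₚ.*-comm Y (X ℕ.^ d₁) ⟩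
      T                                 ∎
      where open ℕₚ.≤-Reasoning

    R : ℕ
    R = ∣ + T - w ∣

    T-w≡R : + T - w ≡ + R
    T-w≡R = n-w≡+∣n-w∣ T w (ℕₚ.<⇒≤ ∣w∣<T)

    R<∣B∣ : R < ∣ B d ∣
    R<∣B∣ = ℕₚ.+-cancelʳ-< (∣ G d ∣) R (∣ B d ∣) R+∣G∣<∣B∣+∣G∣
      where
      open ℕₚ.≤-Reasoning
      collect : ∀ Xᵏ Y D → Xᵏ ℕ.* Y ℕ.+ Xᵏ ℕ.* Y ℕ.+ D ℕ.* Xᵏ ≡ (Y ℕ.+ Y ℕ.+ D) ℕ.* Xᵏ
      collect = ℕ-Solver.solve-∀
      R+∣G∣<∣B∣+∣G∣ : R ℕ.+ ∣ G d ∣ < ∣ B d ∣ ℕ.+ ∣ G d ∣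
      R+∣G∣<∣B∣+∣G∣ = begin-strict
        R ℕ.+ ∣ G d ∣                                 ≤⟨ ℕₚ.+-monoˡ-≤ ∣ G d ∣ (ℤₚ.∣i-j∣≤∣i∣+∣j∣ (+ T) w) ⟩
        T ℕ.+ ∣ w ∣ ℕ.+ ∣ G d ∣                       <⟨ ℕₚ.+-mono-<-≤ (ℕₚ.+-monoʳ-< T ∣w∣<T) ∣G∣≤ ⟩
        T ℕ.+ T ℕ.+ d ℕ.* ‖α‖ ℕ.* X ℕ.^ d₁            ≡⟨ collect (X ℕ.^ d₁) Y (d ℕ.* ‖α‖) ⟩
        (Y ℕ.+ Y ℕ.+ d ℕ.* ‖α‖) ℕ.* X ℕ.^ d₁          ≤⟨ ℕₚ.*-monoˡ-≤ (X ℕ.^ d₁) X-room ⟩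
        X ℕ.* X ℕ.^ d₁                                ≡⟨ sym ∣x^d∣≡ ⟩
        ∣ x ^ d ∣                                     ≤⟨ ∣i∣≤∣i+j∣+∣j∣ (x ^ d) (G d) ⟩
        ∣ B d ∣ ℕ.+ ∣ G d ∣                           ∎

    mod-B : modℤ (+ T - x ^ suc n * sg * H 0 d) (B d) ≡ + R
    mod-B = modℤ-unique _ (B d) (- (sg * S (suc n))) (begin
      + T - x ^ suc n * sg * H 0 d                      ≡⟨ reassoc (+ T) (x ^ suc n) sg (H 0 d) ⟩
      + T - sg * (x ^ suc n * H 0 d)                    ≡⟨ cong (λ t → + T - sg * t) (x^m*H₀≡B*S+H (suc n)) ⟩
      + T - sg * (B d * S (suc n) + H (suc n) d)        ≡⟨ split (+ T) sg (B d) (S (suc n)) (H (suc n) d) ⟩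
      + T - w + - (sg * S (suc n)) * B d                ≡⟨ cong (_+ - (sg * S (suc n)) * B d) T-w≡R ⟩
      + R + - (sg * S (suc n)) * B d                    ∎) R<∣B∣
      where
      open ≡-Reasoning
      reassoc : ∀ t y σ h → t - y * σ * h ≡ t - σ * (y * h)
      reassoc = solve-∀
      split : ∀ t σ b q h → t - σ * (b * q + h) ≡ t - σ * h + - (σ * q) * b
      split = solve-∀

    T′ : ℕ
    T′ = X ℕ.^ d₂ ℕ.* Y

    q : ℤ
    q = + T′ - sg * H (suc n) d₁

    R≡digit+q*x : + R ≡ + (∣ α d ∣ ℕ.* s n) + q * x
    R≡digit+q*x = begin
      + R
        ≡⟨ sym T-w≡R ⟩
      + T - sg * (x * H (suc n) d₁ + partialSum (suc n) d₁)
        ≡⟨ cong₂ (λ t p → t - sg * (x * H (suc n) d₁ + p)) T≡x*T′ (partialSum-last n) ⟩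
      x * + T′ - sg * (x * H (suc n) d₁ + - (α d * + s n))
        ≡⟨ regroup x (+ T′) sg (H (suc n) d₁) (α d) (+ s n) ⟩
      sg * α d * + s n + q * x
        ≡⟨ cong (λ a → a * + s n + q * x) (sgn*self (α d) αd≢0) ⟩
      + ∣ α d ∣ * + s n + q * x
        ≡⟨ cong (_+ q * x) (sym (ℤₚ.pos-* ∣ α d ∣ (s n))) ⟩
      + (∣ α d ∣ ℕ.* s n) + q * x
        ∎
      where
      open ≡-Reasoning
      T≡x*T′ : + T ≡ x * + T′
      T≡x*T′ = trans (cong +_ (ℕₚ.*-assoc X (X ℕ.^ d₂) Y)) (ℤₚ.pos-* X T′)
      regroup : ∀ x t σ h a σₙ → x * t - σ * (x * h + - (a * σₙ)) ≡ σ * a * σₙ + (t - σ * h) * x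
      regroup = solve-∀

    digit<X : ∣ α d ∣ ℕ.* s n < X
    digit<X = begin-strict
      ∣ α d ∣ ℕ.* s n        ≤⟨ ℕₚ.*-mono-≤ (ℕₚ.m≤n⇒m≤1+n (∣α∣≤‖α‖ ℕₚ.≤-refl)) (s≤P n) ⟩
      M ℕ.* P n              ≡⟨ P-suc n ⟩
      P (suc n)              ≤⟨ P≤HB (suc n) ⟩
      HB (suc n)             <⟨ Y-large ⟩
      Y                      ≤⟨ ℕₚ.≤-trans (ℕₚ.≤-trans (ℕₚ.m≤m+n Y Y) (ℕₚ.m≤m+n (Y ℕ.+ Y) _)) X-room ⟩
      X                      ∎
      where open ℕₚ.≤-Reasoning

    numerator : ℤ
    numerator = (+ b) ^ (n ℕ.* d₁ ℕ.+ ⌈ n /2⌉) - (+ b) ^ (n ℕ.* (n ℕ.+ 1)) * sg * eval (Apoly d α s) ((+ b) ^ n)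

    numerator≡ : numerator ≡ + T - x ^ suc n * sg * H 0 d
    numerator≡ = cong₃ (λ t y a → t - y * sg * a) b^[nd₁+h]≡T b^[n[n+1]]≡x^[1+n] A[b^n]≡H₀
      where
      open ≡-Reasoning
      cong₃ : ∀ (f : ℤ → ℤ → ℤ → ℤ) {a a′ b b′ c c′} → a ≡ a′ → b ≡ b′ → c ≡ c′ → f a b c ≡ f a′ b′ c′
      cong₃ f refl refl refl = refl
      b^[nd₁+h]≡T : (+ b) ^ (n ℕ.* d₁ ℕ.+ ⌈ n /2⌉) ≡ + T
      b^[nd₁+h]≡T = trans (pos-^ b (n ℕ.* d₁ ℕ.+ ⌈ n /2⌉)) (cong +_ (begin
        b ℕ.^ (n ℕ.* d₁ ℕ.+ ⌈ n /2⌉)  ≡⟨ ℕₚ.^-distribˡ-+-* b (n ℕ.* d₁) ⌈ n /2⌉ ⟩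
        b ℕ.^ (n ℕ.* d₁) ℕ.* Y        ≡⟨ cong (ℕ._* Y) (sym (ℕₚ.^-*-assoc b n d₁)) ⟩
        T                             ∎))
      b^[n[n+1]]≡x^[1+n] : (+ b) ^ (n ℕ.* (n ℕ.+ 1)) ≡ x ^ suc n
      b^[n[n+1]]≡x^[1+n] = begin
        (+ b) ^ (n ℕ.* (n ℕ.+ 1))  ≡⟨ sym (ℤₚ.^-*-assoc (+ b) n (n ℕ.+ 1)) ⟩
        ((+ b) ^ n) ^ (n ℕ.+ 1)    ≡⟨ cong₂ _^_ (pos-^ b n) (ℕₚ.+-comm n 1) ⟩
        x ^ suc n                  ∎
      A[b^n]≡H₀ : eval (Apoly d α s) ((+ b) ^ n) ≡ H 0 d
      A[b^n]≡H₀ = trans (cong (eval (Apoly d α s)) (pos-^ b n)) eval-Apoly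

    lastDigit : modℤ (modℤ numerator (eval (Bpoly d α) ((+ b) ^ n))) ((+ b) ^ n) ≡ + (∣ α d ∣ ℕ.* s n)
    lastDigit = begin
      modℤ (modℤ numerator (eval (Bpoly d α) ((+ b) ^ n))) ((+ b) ^ n)
        ≡⟨ cong₂ (λ v z → modℤ (modℤ v (eval (Bpoly d α) z)) z) numerator≡ (pos-^ b n) ⟩
      modℤ (modℤ (+ T - x ^ suc n * sg * H 0 d) (eval (Bpoly d α) x)) x
        ≡⟨ cong (λ B → modℤ (modℤ (+ T - x ^ suc n * sg * H 0 d) B) x) eval-Bpoly ⟩
      modℤ (modℤ (+ T - x ^ suc n * sg * H 0 d) (B d)) x
        ≡⟨ cong (λ r → modℤ r x) mod-B ⟩
      modℤ (+ R) x
        ≡⟨ modℤ-unique (+ R) x q R≡digit+q*x digit<X ⟩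
      + (∣ α d ∣ ℕ.* s n)
        ∎
      where open ≡-Reasoning

    eval-Bpoly≢0 : eval (Bpoly d α) ((+ b) ^ n) ≢ + 0
    eval-Bpoly≢0 B≡0 = ℕₚ.n≮0 (subst (λ B → R < ∣ B ∣) (trans B≡eval-Bpoly B≡0) R<∣B∣)
      where
      B≡eval-Bpoly : B d ≡ eval (Bpoly d α) ((+ b) ^ n)
      B≡eval-Bpoly = trans (sym eval-Bpoly) (cong (eval (Bpoly d α)) (sym (pos-^ b n)))

    b^n≢0 : (+ b) ^ n ≢ + 0
    b^n≢0 b^n≡0 = ℕₚ.n≮0 (subst (λ z → 0 < ∣ z ∣) (trans (sym (pos-^ b n)) b^n≡0) 1≤X)

  b₁ b₂ b₃ b₀ : ℕ
  b₁ = suc (‖B⊗S‖ ℕ.+ HB d)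
  b₂ = 2 ℕ.+ d ℕ.* ‖α‖
  b₃ = suc L ℕ.* M ℕ.^ 3
  b₀ = b₁ ℕ.⊔ b₂ ℕ.⊔ b₃

  module _ {b n} (b≥b₀ : b ≥ b₀) (n≥2 : n ≥ 2) where

    private
      b≥b₁⊔b₂ : b₁ ℕ.⊔ b₂ ≤ b
      b≥b₁⊔b₂ = ℕₚ.m⊔n≤o⇒m≤o (b₁ ℕ.⊔ b₂) b₃ b≥b₀

    X-large : ‖B⊗S‖ ℕ.+ HB d < b ℕ.^ n
    X-large = ℕₚ.≤-trans (ℕₚ.m⊔n≤o⇒m≤o b₁ b₂ b≥b₁⊔b₂)
                         (m≤m^n (ℕₚ.≤-trans (s≤s z≤n) b≥b₀) (ℕₚ.≤-trans (s≤s z≤n) n≥2))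

    Y-large : HB (suc n) < b ℕ.^ ⌈ n /2⌉
    Y-large = ℕₚ.<-≤-trans (L*M^m<[[1+L]*M^k]^h L {M} {suc n} {3} (s≤s z≤n) (1≤⌈n/2⌉ n≥2) (1+n≤3*⌈n/2⌉ n≥2))
                           (ℕₚ.^-monoˡ-≤ ⌈ n /2⌉ (ℕₚ.m⊔n≤o⇒n≤o (b₁ ℕ.⊔ b₂) b₃ b≥b₀))

    X-room : b ℕ.^ ⌈ n /2⌉ ℕ.+ b ℕ.^ ⌈ n /2⌉ ℕ.+ d ℕ.* ‖α‖ ≤ b ℕ.^ n
    X-room = b^h+b^h+D≤b^n (d ℕ.* ‖α‖) (ℕₚ.m⊔n≤o⇒n≤o b₁ b₂ b≥b₁⊔b₂) (⌈n/2⌉<n n≥2)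

theorem3 : (d : ℕ) → 2 ≤ d → (α : ℕ → ℤ) → α d ≢ + 0 → (s : ℕ → ℕ)
    → (∀ n → (+ s (n Data.Nat.+ d)) + recSum d α s n ≡ + 0)
    → Σ ℕ λ n₀ → Σ ℕ λ b₀ → ∀ b → b ≥ b₀ → ∀ n → n ≥ n₀
    → (eval (Bpoly d α) ((+ b) ^ n) ≢ + 0) × ((+ b) ^ n ≢ + 0)
      × (+ (∣ α d ∣ Data.Nat.* s n)
         ≡ modℤ (modℤ (((+ b) ^ (n Data.Nat.* (d Data.Nat.∸ 1) Data.Nat.+ ⌈ n /2⌉))
                        - ((+ b) ^ (n Data.Nat.* (n Data.Nat.+ 1))) * sgn (α d) * eval (Apoly d α s) ((+ b) ^ n))
                       (eval (Bpoly d α) ((+ b) ^ n)))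
                 ((+ b) ^ n))
theorem3 (suc zero)     (s≤s ()) α αd≢0 s rec
theorem3 (suc (suc d₂)) _ α αd≢0 s rec = 2 , b₀ , λ b b≥b₀ n n≥2 →
  let open Digits b n (X-large b≥b₀ n≥2) (Y-large b≥b₀ n≥2) (X-room b≥b₀ n≥2)
  in  eval-Bpoly≢0 , b^n≢0 , sym lastDigit
  where open LastDigit d₂ α s rec αd≢0
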